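{- There is an absolute constant $c$ such that for every $v\in R$, $\sum_{i\in U_v}x_{i,C}\,d(i,v)\le c\,D_{U_v}$.
   Context: Instance: finite facility set $F$ with capacities $u_i\in\mathbb{Z}_{>0}$, finite client set $C$, metric $d$ on $F\cup C$, integer $k$. Fix a feasible solution $(x,y)$ of the basic LP: $\sum_{i\in F}y_i\le k$; $\sum_{i\in F}x_{i,j}=1$ for all $j\in C$; $x_{i,j}\le y_i$; $\sum_{j\in C}x_{i,j}\le u_iy_i$; $0\le x_{i,j},y_i\le 1$. Notation: $d_{\mathsf{av}}(j)=\sum_{i\in F}x_{i,j}d(i,j)$; $D_i=\sum_{j\in C}x_{i,j}(d(i,j)+d_{\mathsf{av}}(j))$; $D_S=\sum_{i\in S}D_i$ for $S\subseteq F$; $x_{i,C}=\sum_{j\in C}x_{i,j}$. Construction of $R\subseteq C$: start with $R=\emptyset$, $C'=C$; while $C'\neq\emptyset$, pick $v\in C'$ with smallest $d_{\mathsf{av}}(v)$, add it to $R$, and remove from $C'$ all $j\in C'$ with $d(j,v)\le 4d_{\mathsf{av}}(j)$. Each $i\in F$ is put into $U_v$ for a closest $v\in R$ (ties arbitrary), so $\{U_v\}_{v\in R}$ partitions $F$.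
   Formalization: The metric d and the feasible solution $(x,y)$ of the basic LP take only rational values. -}

module Defs where

open import Data.Nat using (ℕ; zero; suc) renaming (_<_ to _<ℕ_)
open import Data.Integer using (+_)
open import Data.Fin using (Fin; zero; suc) renaming (_≟_ to _≟F_)
open import Data.Sum using (_⊎_; inj₁; inj₂)
open import Data.Product using (_×_)
open import Data.List using (List; []; _∷_; filter)
open import Data.List.Membership.Propositional using (_∈_)
open import Data.Rational using (ℚ; 0ℚ; _+_; _*_; _≤_; _/_)
open import Data.Rational.Properties using (_≤?_)

open import Relation.Nullary.Decidable using (⌊_⌋; ¬?)
open import Relation.Binary.PropositionalEquality using (_≡_)
open import Data.Bool using (if_then_else_)

∑ : (n : ℕ) → (Fin n → ℚ) → ℚ
∑ zero    f = 0ℚ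
∑ (suc n) f = f zero + ∑ n (λ i → f (suc i))

Pt : ℕ → ℕ → Set
Pt nF nC = Fin nF ⊎ Fin nC

record IsMetric {A : Set} (d : A → A → ℚ) : Set where
  field
    nonneg  : ∀ p q → 0ℚ ≤ d p q
    zero-self : ∀ p → d p p ≡ 0ℚ
    zero-eq : ∀ p q → d p q ≡ 0ℚ → p ≡ q
    sym     : ∀ p q → d p q ≡ d q p
    triangle : ∀ p q r → d p r ≤ d p q + d q r

ℚ[_] : ℕ → ℚ
ℚ[ n ] = + n / 1

record LPFeasible (nF nC : ℕ) (u : Fin nF → ℕ) (k : ℕ)
                  (x : Fin nF → Fin nC → ℚ) (y : Fin nF → ℚ) : Set where
  field
    budget   : ∑ nF y ≤ ℚ[ k ]
    assign   : ∀ j → ∑ nF (λ i → x i j) ≡ ℚ[ 1 ]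
    x≤y      : ∀ i j → x i j ≤ y i
    capacity : ∀ i → ∑ nC (λ j → x i j) ≤ ℚ[ u i ] * y i
    x≥0      : ∀ i j → 0ℚ ≤ x i j
    x≤1      : ∀ i j → x i j ≤ ℚ[ 1 ]
    y≥0      : ∀ i → 0ℚ ≤ y i
    y≤1      : ∀ i → y i ≤ ℚ[ 1 ]

module Instance (nF nC : ℕ) (d : Pt nF nC → Pt nF nC → ℚ)
                (x : Fin nF → Fin nC → ℚ) where

  dFC : Fin nF → Fin nC → ℚ
  dFC i j = d (inj₁ i) (inj₂ j)

  dCC : Fin nC → Fin nC → ℚ
  dCC j j' = d (inj₂ j) (inj₂ j')

  dav : Fin nC → ℚ
  dav j = ∑ nF (λ i → x i j * dFC i j)

  D : Fin nF → ℚ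
  D i = ∑ nC (λ j → x i j * (dFC i j + dav j))

  xC : Fin nF → ℚ
  xC i = ∑ nC (λ j → x i j)


  -- Greedy construction of R: `Greedy C' R` means that running the
  -- while-loop starting from the current client set C' (as a list) may
  -- produce the (ordered) list R of selected clients, for some choice of
  -- tie-breaking.
  data Greedy : List (Fin nC) → List (Fin nC) → Set where
    done : Greedy [] []
    step : ∀ {C' R} (v : Fin nC) →
           v ∈ C' →
           (∀ j → j ∈ C' → dav v ≤ dav j) →
           Greedy (filter (λ j → ¬? (dCC j v ≤? (ℚ[ 4 ] * dav j))) C') R →
           Greedy C' (v ∷ R)

  record ClosestAssignment (R : List (Fin nC)) (σ : Fin nF → Fin nC) : Set where
    field
      inR     : ∀ i → σ i ∈ R
      closest : ∀ i v → v ∈ R → dFC i (σ i) ≤ dFC i v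

  ∑U : (σ : Fin nF → Fin nC) → Fin nC → (Fin nF → ℚ) → ℚ
  ∑U σ v f = ∑ nF (λ i → if ⌊ σ i ≟F v ⌋ then f i else 0ℚ)

{-# OPTIONS --safe #-}
-- Every client j is within 4·d_av(j) of some centre in R, because the greedy
-- loop only discards j next to a centre it has just chosen.  A facility i in
-- U_v is at least as close to v as to that centre, so for every client j
--   d(i,v) ≤ d(i,j) + 4·d_av(j) ≤ 4·(d(i,j) + d_av(j)).
-- Weighting by x_{i,j} and summing over j gives x_{i,C}·d(i,v) ≤ 4·D_i, and
-- summing over U_v gives the lemma with c = 4.
module Submission where

open import Defs
open import Data.Nat using (ℕ; zero; suc) renaming (_<_ to _<ℕ_)
open import Data.Fin using (Fin) renaming (_≟_ to _≟F_)
open import Data.Product using (Σ; ∃-syntax; _×_; _,_)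
open import Data.Sum using (inj₁; inj₂)
open import Data.List using (List; allFin)
open import Data.List.Membership.Propositional using (_∈_)
open import Data.List.Membership.Propositional.Properties using (∈-filter⁺; ∈-allFin)
open import Data.List.Relation.Unary.Any using (here; there)
open import Data.Rational using (ℚ; _*_; _≤_; _+_; 0ℚ; 1ℚ; nonNegative)
open import Data.Rational.Properties
open import Relation.Nullary using (yes; no)
open import Relation.Nullary.Decidable using (⌊_⌋; ¬?; from-yes)
open import Relation.Binary.PropositionalEquality using (_≡_; refl; sym; cong)
open import Data.Bool using (if_then_else_)

∑-mono-≤ : ∀ n {f g : Fin n → ℚ} → (∀ i → f i ≤ g i) → ∑ n f ≤ ∑ n g
∑-mono-≤ zero    f≤g = ≤-refl
∑-mono-≤ (suc n) f≤g = +-mono-≤ (f≤g Fin.zero) (∑-mono-≤ n (λ i → f≤g (Fin.suc i)))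

∑-distribˡ : ∀ n c (f : Fin n → ℚ) → c * ∑ n f ≡ ∑ n (λ i → c * f i)
∑-distribˡ zero    c f = *-zeroʳ c
∑-distribˡ (suc n) c f
  rewrite *-distribˡ-+ c (f Fin.zero) (∑ n (λ i → f (Fin.suc i)))
  = cong (c * f Fin.zero +_) (∑-distribˡ n c (λ i → f (Fin.suc i)))

∑-distribʳ : ∀ n (f : Fin n → ℚ) c → ∑ n f * c ≡ ∑ n (λ i → f i * c)
∑-distribʳ zero    f c = *-zeroˡ c
∑-distribʳ (suc n) f c
  rewrite *-distribʳ-+ c (f Fin.zero) (∑ n (λ i → f (Fin.suc i)))
  = cong (f Fin.zero * c +_) (∑-distribʳ n (λ i → f (Fin.suc i)) c)

∑-≤-* : ∀ n c {f g : Fin n → ℚ} → (∀ i → f i ≤ c * g i) → ∑ n f ≤ c * ∑ n g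
∑-≤-* n c {f} {g} f≤cg = begin
  ∑ n f                  ≤⟨ ∑-mono-≤ n f≤cg ⟩
  ∑ n (λ i → c * g i)    ≡⟨ sym (∑-distribˡ n c g) ⟩
  c * ∑ n g              ∎
  where open ≤-Reasoning

p≤4*p : ∀ {p} → 0ℚ ≤ p → p ≤ ℚ[ 4 ] * p
p≤4*p {p} 0≤p = begin
  p               ≡⟨ sym (*-identityˡ p) ⟩
  1ℚ * p          ≤⟨ *-monoʳ-≤-nonNeg p {{nonNegative 0≤p}} (from-yes (1ℚ ≤? ℚ[ 4 ])) ⟩
  ℚ[ 4 ] * p      ∎
  where open ≤-Reasoning

module _ (nF nC : ℕ) (d : Pt nF nC → Pt nF nC → ℚ) (x : Fin nF → Fin nC → ℚ) where
  open Instance nF nC d x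

  Greedy-covers : ∀ {C' R} → Greedy C' R →
                  ∀ {j} → j ∈ C' → ∃[ w ] w ∈ R × dCC j w ≤ ℚ[ 4 ] * dav j
  Greedy-covers (step v _ _ greedy) {j} j∈C' with dCC j v ≤? ℚ[ 4 ] * dav j
  ... | yes j-near-v = v , here refl , j-near-v
  ... | no  j-far-v
    with w , w∈R , j-near-w ← Greedy-covers greedy
           (∈-filter⁺ (λ j → ¬? (dCC j v ≤? ℚ[ 4 ] * dav j)) j∈C' j-far-v)
    = w , there w∈R , j-near-w

  ∑U-≤-* : ∀ σ v c {f g : Fin nF → ℚ} → (∀ i → σ i ≡ v → f i ≤ c * g i) →
           ∑U σ v f ≤ c * ∑U σ v g
  ∑U-≤-* σ v c {f} {g} f≤cg = ∑-≤-* nF c restricted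
    where
    restricted : ∀ i → (if ⌊ σ i ≟F v ⌋ then f i else 0ℚ) ≤ c * (if ⌊ σ i ≟F v ⌋ then g i else 0ℚ)
    restricted i with σ i ≟F v
    ... | yes σi≡v = f≤cg i σi≡v
    ... | no  _    = ≤-reflexive (sym (*-zeroʳ c))

  module _ (metric : IsMetric d) {R} (greedy : Greedy (allFin nC) R)
           {σ} (closest : ClosestAssignment R σ) where
    open IsMetric metric using (nonneg; triangle)

    dist-assigned≤ : ∀ i j → dFC i (σ i) ≤ ℚ[ 4 ] * (dFC i j + dav j)
    dist-assigned≤ i j with w , w∈R , j-near-w ← Greedy-covers greedy (∈-allFin j) = begin
      dFC i (σ i)                          ≤⟨ ClosestAssignment.closest closest i w w∈R ⟩
      dFC i w                              ≤⟨ triangle (inj₁ i) (inj₂ j) (inj₂ w) ⟩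
      dFC i j + dCC j w                    ≤⟨ +-mono-≤ (p≤4*p (nonneg _ _)) j-near-w ⟩
      ℚ[ 4 ] * dFC i j + ℚ[ 4 ] * dav j    ≡⟨ sym (*-distribˡ-+ ℚ[ 4 ] (dFC i j) (dav j)) ⟩
      ℚ[ 4 ] * (dFC i j + dav j)           ∎
      where open ≤-Reasoning

    xC*dist-assigned≤ : (∀ i j → 0ℚ ≤ x i j) → ∀ i → xC i * dFC i (σ i) ≤ ℚ[ 4 ] * D i
    xC*dist-assigned≤ x≥0 i = begin
      xC i * dFC i (σ i)                       ≡⟨ ∑-distribʳ nC (x i) (dFC i (σ i)) ⟩
      ∑ nC (λ j → x i j * dFC i (σ i))         ≤⟨ ∑-≤-* nC ℚ[ 4 ] weighted ⟩
      ℚ[ 4 ] * D i                             ∎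
      where
      open ≤-Reasoning
      weighted : ∀ j → x i j * dFC i (σ i) ≤ ℚ[ 4 ] * (x i j * (dFC i j + dav j))
      weighted j = begin
        x i j * dFC i (σ i)                    ≤⟨ *-monoˡ-≤-nonNeg (x i j) {{nonNegative (x≥0 i j)}} (dist-assigned≤ i j) ⟩
        x i j * (ℚ[ 4 ] * (dFC i j + dav j))   ≡⟨ sym (*-assoc (x i j) ℚ[ 4 ] _) ⟩
        x i j * ℚ[ 4 ] * (dFC i j + dav j)     ≡⟨ cong (_* (dFC i j + dav j)) (*-comm (x i j) ℚ[ 4 ]) ⟩
        ℚ[ 4 ] * x i j * (dFC i j + dav j)     ≡⟨ *-assoc ℚ[ 4 ] (x i j) _ ⟩
        ℚ[ 4 ] * (x i j * (dFC i j + dav j))   ∎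

lemma3p2 : Σ ℚ λ c →
    (nF nC : ℕ) (u : Fin nF → ℕ) → (∀ i → 0 <ℕ u i) →
    (d : Pt nF nC → Pt nF nC → ℚ) → IsMetric d →
    (k : ℕ) (x : Fin nF → Fin nC → ℚ) (y : Fin nF → ℚ) →
    LPFeasible nF nC u k x y →
    (R : List (Fin nC)) → Instance.Greedy nF nC d x (allFin nC) R →
    (σ : Fin nF → Fin nC) → Instance.ClosestAssignment nF nC d x R σ →
    (v : Fin nC) → v ∈ R →
    Instance.∑U nF nC d x σ v (λ i → Instance.xC nF nC d x i * Instance.dFC nF nC d x i v)
      ≤ c * Instance.∑U nF nC d x σ v (Instance.D nF nC d x)
lemma3p2 = ℚ[ 4 ] , λ nF nC _ _ d metric _ x _ feasible _ greedy σ closest v _ →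
  ∑U-≤-* nF nC d x σ v ℚ[ 4 ] λ { i refl →
    xC*dist-assigned≤ nF nC d x metric greedy closest (LPFeasible.x≥0 feasible) i }
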